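{- Let $p$ be a prime, let $\lambda>0$ be an integer and let $y\in\mathbb Z$ with either $y>0$ or $y<1-\lambda$. Then $$\frac{\lambda}{p-1}-\lceil\log_p(\lambda)\rceil-1\ \le\ \sum_{i=0}^{\lambda-1}v_p(y+i)\ \le\ \frac{\lambda-1}{p-1}+\max\bigl\{\lfloor\log_p(|y|)\rfloor,\ \lfloor\log_p(|y+\lambda-1|)\rfloor\bigr\}.$$
   Context: $v_p$ is the $p$-adic valuation on $\mathbb Z\setminus\{0\}$, and $\log_p$ denotes the real logarithm to base $p$ (not a $p$-adic logarithm). -}

module Defs where

open import Data.Nat using (ℕ; zero; suc; _^_; _≤?_; _∸_)
open import Data.Nat.Divisibility using (_∣?_; divides)
open import Data.Bool using (Bool; true; false; if_then_else_)
open import Data.Integer using (ℤ; +_)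
open import Data.Rational using (ℚ; _/_)
open import Relation.Nullary using (yes; no)
open import Relation.Nullary.Decidable using (⌊_⌋)

-- For p ≥ 2 and n ≥ 1, fuel n suffices, so vpℕ p n = max{k : p^k ∣ n}.
-- (Only meaningful for p ≥ 2, n ≠ 0; we only use it for p prime, n ≠ 0.)
vpFuel : ℕ → ℕ → ℕ → ℕ
vpFuel zero    p n       = 0
vpFuel (suc f) p zero    = 0
vpFuel (suc f) p (suc n) with p ∣? suc n
... | yes (divides q _) = suc (vpFuel f p q)
... | no  _             = 0

vpℕ : ℕ → ℕ → ℕ
vpℕ p n = vpFuel n p n

vp : ℕ → ℤ → ℕ
vp p z = vpℕ p (Data.Integer.∣ z ∣)

greatestUpTo : (ℕ → Bool) → ℕ → ℕ
greatestUpTo P zero    = 0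
greatestUpTo P (suc b) = if P (suc b) then suc b else greatestUpTo P b

leastFromTo : (ℕ → Bool) → ℕ → ℕ → ℕ
leastFromTo P k zero    = k
leastFromTo P k (suc r) = if P k then k else leastFromTo P (suc k) r

-- ⌊log_p n⌋ for n ≥ 1, p ≥ 2: the largest k with p^k ≤ n (necessarily k ≤ n)
floorLog : ℕ → ℕ → ℕ
floorLog p n = greatestUpTo (λ k → ⌊ p ^ k ≤? n ⌋) n

-- ⌈log_p n⌉ for n ≥ 1, p ≥ 2: the least k with n ≤ p^k (necessarily k ≤ n)
ceilLog : ℕ → ℕ → ℕ
ceilLog p n = leastFromTo (λ k → ⌊ n ≤? p ^ k ⌋) 0 n

-- the rational number x / (p - 1), for p ≥ 2 (junk value 0 for p < 2)
divPm1 : ℤ → ℕ → ℚ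
divPm1 x zero          = + 0 / 1
divPm1 x (suc zero)    = + 0 / 1
divPm1 x (suc (suc k)) = x / suc k

toℚ : ℕ → ℚ
toℚ n = + n / 1

module Submission where

-- Write p = k + 2 and P = p - 1.  Under the
-- hypotheses on y the numbers |y|, …, |y+λ-1| are, up to order, a block of consecutive
-- positive integers a, a+1, …, a+λ-1 whose largest element is |y| or |y+λ-1|.  So it
-- suffices to bound block sums  block a l = v(a) + … + v(a+l-1)  for a ≥ 1.
--
-- The key identity ('Reduction'): pad [a, a+l) on each side by fewer than p integers to
-- reach an interval [p(A+1), p(A+1+l')) between consecutive multiples of p.  The padding
-- contains no multiples of p, and v(p·m) = 1 + v(m), hence
--     block a l = l' + block (A+1) l'    with    l' = (l + d₂ - d₁)/p,  d₁, d₂ < p.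
-- Iterating this at most ⌈log_p l⌉ (resp. ⌊log_p (a+l-1)⌋) times gives the integral
-- inequalities  l ≤ P·(block a l + ⌈log_p l⌉ + 1)  and  P·block a l ≤ (l-1) + P·⌊log_p(a+l-1)⌋
-- ('block-lower', 'block-upper').  The theorem follows after dividing by P in ℚ.

open import Defs
open import Data.Nat using (ℕ)

module BlockSums (k : ℕ) where
  open import Data.Nat
  open import Data.Nat.Properties
  open import Data.Nat.Divisibility using (_∣_; _∣?_; divides)
  open import Data.Nat.Solver using (module +-*-Solver)
  open +-*-Solver using (solve; _:+_; _:*_; _:=_; con)
  open import Data.Nat.ListAction using (sum)
  open import Data.Integer as ℤ using (ℤ; ∣_∣)
  import Data.Integer.Properties as ℤP
  open import Data.Bool using (Bool; T; true; false)
  open import Data.Product using (_×_; _,_; ∃₂)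
  open import Data.Sum using (_⊎_; inj₁; inj₂)
  open import Data.Empty using (⊥-elim)
  open import Data.List using (map; upTo; applyUpTo)
  open import Data.List.Properties using (map-applyUpTo)
  open import Relation.Nullary using (¬_; yes; no)
  open import Relation.Nullary.Decidable using (⌊_⌋; toWitness; fromWitness)
  open import Relation.Binary.PropositionalEquality

  p P : ℕ
  p = suc (suc k)
  P = suc k

  v : ℕ → ℕ
  v = vpℕ p

  vpFuel-zero : ∀ f → vpFuel f p 0 ≡ 0
  vpFuel-zero zero    = refl
  vpFuel-zero (suc f) = refl

  -- The cofactor of a positive multiple of p is smaller than it; this is why the fuel
  -- n in vpℕ p n is enough.
  cofactor≤ : ∀ q n → suc n ≡ q * p → q ≤ n
  cofactor≤ zero    n _  = z≤n
  cofactor≤ (suc q) n eq = ≤-pred (subst (suc q <_) (sym eq) (m<m*n (suc q) p (s≤s (s≤s z≤n))))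

  vpFuel-stable : ∀ f g n → n ≤ f → n ≤ g → vpFuel f p n ≡ vpFuel g p n
  vpFuel-stable f g zero _ _ = trans (vpFuel-zero f) (sym (vpFuel-zero g))
  vpFuel-stable (suc f) (suc g) (suc n) (s≤s n≤f) (s≤s n≤g) with p ∣? suc n
  ... | yes (divides q eq) = cong suc (vpFuel-stable f g q (≤-trans (cofactor≤ q n eq) n≤f)
                                                           (≤-trans (cofactor≤ q n eq) n≤g))
  ... | no _ = refl

  v-indivisible : ∀ n → ¬ p ∣ n → v n ≡ 0
  v-indivisible zero    _   = refl
  v-indivisible (suc n) p∤n with p ∣? suc n
  ... | yes p∣n = ⊥-elim (p∤n p∣n)
  ... | no  _   = refl

  v-multiple : ∀ m → v (p * suc m) ≡ suc (v (suc m))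
  v-multiple m = unfold _ refl
    where
    unfold : ∀ n → suc n ≡ p * suc m → v (suc n) ≡ suc (v (suc m))
    unfold n e with p ∣? suc n
    ... | yes (divides q eq) =
          cong suc (trans (vpFuel-stable n q q (cofactor≤ q n eq) ≤-refl) (cong v q≡1+m))
      where
      q≡1+m : q ≡ suc m
      q≡1+m = *-cancelʳ-≡ q (suc m) p (trans (sym eq) (trans e (*-comm p (suc m))))
    ... | no p∤n = ⊥-elim (p∤n (divides (suc m) (trans e (*-comm p (suc m)))))

  indivisible-below-multiple : ∀ x d m → 0 < d → d ≤ P → x + d ≡ p * m → ¬ p ∣ x
  indivisible-below-multiple .(q * p) d m 0<d d≤P e (divides q refl) = <⇒≱ (s≤s d≤P) p≤d
    where
    open ≤-Reasoning
    q<m : q < m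
    q<m = *-cancelʳ-< p q m (begin-strict
      q * p      <⟨ m<m+n (q * p) 0<d ⟩
      q * p + d  ≡⟨ e ⟩
      p * m      ≡⟨ *-comm p m ⟩
      m * p      ∎)
    p≤d : p ≤ d
    p≤d = +-cancelʳ-≤ (q * p) p d (begin
      p + q * p  ≤⟨ *-monoˡ-≤ p q<m ⟩
      m * p      ≡⟨ *-comm m p ⟩
      p * m      ≡⟨ e ⟨
      q * p + d  ≡⟨ +-comm (q * p) d ⟩
      d + q * p  ∎)

  block : ℕ → ℕ → ℕ
  block a zero    = 0
  block a (suc l) = v a + block (suc a) l

  block-++ : ∀ a m n → block a (m + n) ≡ block a m + block (a + m) n
  block-++ a zero    n = cong (λ b → block b n) (sym (+-identityʳ a))
  block-++ a (suc m) n = begin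
    v a + block (suc a) (m + n)                    ≡⟨ cong (v a +_) (block-++ (suc a) m n) ⟩
    v a + (block (suc a) m + block (suc a + m) n)  ≡⟨ cong (λ b → v a + (block (suc a) m + block b n)) (sym (+-suc a m)) ⟩
    v a + (block (suc a) m + block (a + suc m) n)  ≡⟨ +-assoc (v a) _ _ ⟨
    v a + block (suc a) m + block (a + suc m) n    ∎
    where open ≡-Reasoning

  block-snoc : ∀ a m → block a (suc m) ≡ block a m + v (a + m)
  block-snoc a m = begin
    block a (suc m)              ≡⟨ cong (block a) (+-comm 1 m) ⟩
    block a (m + 1)              ≡⟨ block-++ a m 1 ⟩
    block a m + (v (a + m) + 0)  ≡⟨ cong (block a m +_) (+-identityʳ _) ⟩
    block a m + v (a + m)        ∎
    where open ≡-Reasoning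

  block-free : ∀ d x m → d ≤ P → x + d ≡ p * m → block x d ≡ 0
  block-free zero    x m _   _ = refl
  block-free (suc d) x m d<P e =
    cong₂ _+_ (v-indivisible x (indivisible-below-multiple x (suc d) m (s≤s z≤n) d<P e))
              (block-free d (suc x) m (<⇒≤ d<P) (trans (sym (+-suc x d)) e))

  block-aligned : ∀ l A → block (p * suc A) (p * l) ≡ l + block (suc A) l
  block-aligned zero    A = cong (block (p * suc A)) (*-zeroʳ p)
  block-aligned (suc l) A = begin
    block (p * suc A) (p * suc l)                          ≡⟨ cong (block (p * suc A)) (*-suc p l) ⟩
    block (p * suc A) (p + p * l)                          ≡⟨ block-++ (p * suc A) p (p * l) ⟩
    block (p * suc A) p + block (p * suc A + p) (p * l)    ≡⟨ cong₂ _+_ first-period (cong (λ b → block b (p * l)) next) ⟩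
    suc (v (suc A)) + block (p * suc (suc A)) (p * l)      ≡⟨ cong (suc (v (suc A)) +_) (block-aligned l (suc A)) ⟩
    suc (v (suc A)) + (l + block (suc (suc A)) l)          ≡⟨ solve 3 (λ a l b → con 1 :+ a :+ (l :+ b) := con 1 :+ l :+ (a :+ b))
                                                                    refl (v (suc A)) l (block (suc (suc A)) l) ⟩
    suc l + (v (suc A) + block (suc (suc A)) l)            ∎
    where
    open ≡-Reasoning
    next : p * suc A + p ≡ p * suc (suc A)
    next = trans (+-comm (p * suc A) p) (sym (*-suc p (suc A)))
    first-period : block (p * suc A) p ≡ suc (v (suc A))
    first-period = begin
      v (p * suc A) + block (suc (p * suc A)) P  ≡⟨ cong₂ _+_ (v-multiple A)
                                                        (block-free P (suc (p * suc A)) (suc (suc A)) ≤-refl (trans (sym (+-suc (p * suc A) P)) next)) ⟩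
      suc (v (suc A)) + 0                        ≡⟨ +-identityʳ _ ⟩
      suc (v (suc A))                            ∎

  roundUp : ∀ x → ∃₂ λ a d → d ≤ P × x + d ≡ p * a
  roundUp zero = 0 , 0 , z≤n , sym (*-zeroʳ p)
  roundUp (suc x) with roundUp x
  ... | a , suc d , d<P , e = a , d , <⇒≤ d<P , trans (sym (+-suc x d)) e
  ... | a , zero  , _   , e = suc a , P , ≤-refl , (begin
    suc (x + P)  ≡⟨ cong suc (+-comm x P) ⟩
    p + x        ≡⟨ cong (p +_) (trans (sym (+-identityʳ x)) e) ⟩
    p + p * a    ≡⟨ *-suc p a ⟨
    p * suc a    ∎)
    where open ≡-Reasoning

  shrink : ∀ n j → p * n ≤ p ^ suc j + P → n ≤ p ^ j
  shrink n j h = ≤-pred (*-cancelˡ-< p n (suc (p ^ j)) (begin-strict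
    p * n              ≤⟨ h ⟩
    p ^ suc j + P      <⟨ +-monoʳ-< (p ^ suc j) (n<1+n P) ⟩
    p * p ^ j + p      ≡⟨ +-comm (p * p ^ j) p ⟩
    p + p * p ^ j      ≡⟨ *-suc p (p ^ j) ⟨
    p * suc (p ^ j)    ∎))
    where open ≤-Reasoning

  -- Padding [a, a+l) on the left by d₁ and on the right by d₂ (both < p) gives the
  -- interval [p·(A+1), p·(A+1+l′)) of whole periods.
  record Reduction (a l : ℕ) : Set where
    constructor reduction
    field
      A l′ d₁ d₂ : ℕ
      d₁≤P : d₁ ≤ P
      d₂≤P : d₂ ≤ P
      start : a + d₁ ≡ p * suc A
      end   : a + l + d₂ ≡ p * (suc A + l′)

  module _ {a l : ℕ} (r : Reduction a l) where
    open Reduction r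

    length≡ : d₁ + p * l′ ≡ l + d₂
    length≡ = +-cancelˡ-≡ a _ _ (begin
      a + (d₁ + p * l′)     ≡⟨ +-assoc a d₁ (p * l′) ⟨
      a + d₁ + p * l′       ≡⟨ cong (_+ p * l′) start ⟩
      p * suc A + p * l′    ≡⟨ *-distribˡ-+ p (suc A) l′ ⟨
      p * (suc A + l′)      ≡⟨ end ⟨
      a + l + d₂            ≡⟨ +-assoc a l d₂ ⟩
      a + (l + d₂)          ∎)
      where open ≡-Reasoning

    block≡ : block a l ≡ l′ + block (suc A) l′
    block≡ = begin
      block a l                             ≡⟨ +-identityʳ _ ⟨
      block a l + 0                         ≡⟨ cong (block a l +_) (block-free d₂ (a + l) (suc A + l′) d₂≤P end) ⟨
      block a l + block (a + l) d₂          ≡⟨ block-++ a l d₂ ⟨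
      block a (l + d₂)                      ≡⟨ cong (block a) length≡ ⟨
      block a (d₁ + p * l′)                 ≡⟨ block-++ a d₁ (p * l′) ⟩
      block a d₁ + block (a + d₁) (p * l′)  ≡⟨ cong₂ _+_ (block-free d₁ a (suc A) d₁≤P start)
                                                        (cong (λ b → block b (p * l′)) start) ⟩
      block (p * suc A) (p * l′)            ≡⟨ block-aligned l′ A ⟩
      l′ + block (suc A) l′                 ∎
      where open ≡-Reasoning

    reduced-length : ∀ j → l ≤ p ^ suc j → l′ ≤ p ^ j
    reduced-length j l≤p^j = shrink l′ j (begin
      p * l′         ≤⟨ m≤n+m (p * l′) d₁ ⟩
      d₁ + p * l′    ≡⟨ length≡ ⟩
      l + d₂         ≤⟨ +-mono-≤ l≤p^j d₂≤P ⟩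
      p ^ suc j + P  ∎)
      where open ≤-Reasoning

    reduced-top : ∀ K → a + l ≤ p ^ suc K → suc A + l′ ≤ p ^ K
    reduced-top K h = shrink (suc A + l′) K (≤-trans (≤-reflexive (sym end)) (+-mono-≤ h d₂≤P))

  roundUp-mono : ∀ a l a′ b d₁ d₂ → d₁ ≤ P → a + d₁ ≡ p * a′ → a + l + d₂ ≡ p * b → a′ ≤ b
  roundUp-mono a l a′ b d₁ d₂ d₁≤P e₁ e₂ = ≤-pred (*-cancelˡ-< p a′ (suc b) (begin-strict
    p * a′          ≡⟨ e₁ ⟨
    a + d₁          <⟨ +-monoʳ-< a (s≤s d₁≤P) ⟩
    a + p           ≤⟨ +-monoˡ-≤ p (≤-trans (m≤m+n a l) (m≤m+n (a + l) d₂)) ⟩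
    a + l + d₂ + p  ≡⟨ cong (_+ p) e₂ ⟩
    p * b + p       ≡⟨ +-comm (p * b) p ⟩
    p + p * b       ≡⟨ *-suc p b ⟨
    p * suc b       ∎))
    where open ≤-Reasoning

  -- Every block with a ≥ 1 admits a reduction; a ≥ 1 makes the first multiple positive.
  reduce : ∀ a l → 1 ≤ a → Reduction a l
  reduce a l 1≤a with roundUp a | roundUp (a + l)
  ... | zero , d₁ , _ , e₁ | _ =
        ⊥-elim (<⇒≱ (≤-trans 1≤a (m≤m+n a d₁)) (≤-reflexive (trans e₁ (*-zeroʳ p))))
  ... | suc A , d₁ , d₁≤P , e₁ | b , d₂ , d₂≤P , e₂
    with m≤n⇒∃[o]m+o≡n (roundUp-mono a l (suc A) b d₁ d₂ d₁≤P e₁ e₂)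
  ... | l′ , refl = reduction A l′ d₁ d₂ d₁≤P d₂≤P e₁ e₂

  block-lower : ∀ j a l → 1 ≤ a → l ≤ p ^ j → l ≤ P * (block a l + j + 1)
  block-lower zero a l _ l≤1 = ≤-trans l≤1 (*-mono-≤ {1} {P} (s≤s z≤n) (m≤n+m 1 (block a l + 0)))
  block-lower (suc j) a l 1≤a l≤p^j with reduce a l 1≤a
  ... | r@(reduction A l′ d₁ d₂ d₁≤P _ _ _) = begin
    l                                     ≤⟨ m≤m+n l d₂ ⟩
    l + d₂                                ≡⟨ length≡ r ⟨
    d₁ + p * l′                           ≤⟨ +-mono-≤ d₁≤P (+-monoˡ-≤ (P * l′) IH) ⟩
    P + (P * (B + j + 1) + P * l′)        ≡⟨ solve 4 (λ P B j l → P :+ (P :* (B :+ j :+ con 1) :+ P :* l)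
                                                       := P :* (l :+ B :+ (con 1 :+ j) :+ con 1)) refl P B j l′ ⟩
    P * (l′ + B + suc j + 1)              ≡⟨ cong (λ s → P * (s + suc j + 1)) (block≡ r) ⟨
    P * (block a l + suc j + 1)           ∎
    where
    open ≤-Reasoning
    B = block (suc A) l′
    IH : l′ ≤ P * (B + j + 1)
    IH = block-lower j (suc A) l′ (s≤s z≤n) (reduced-length r j l≤p^j)

  block-upper : ∀ K a n → 1 ≤ a → a + suc n ≤ p ^ suc K → P * block a (suc n) ≤ n + P * K
  block-upper K a n 1≤a h with reduce a (suc n) 1≤a
  block-upper K a n 1≤a h | r@(reduction A zero _ _ _ _ _ _) =
    ≤-trans (≤-reflexive (trans (cong (P *_) (block≡ r)) (*-zeroʳ P))) z≤n
  block-upper zero a n 1≤a h | r@(reduction A (suc m) _ _ _ _ _ _) =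
    ⊥-elim (<⇒≱ (s≤s (≤-trans (s≤s z≤n) (m≤n+m (suc m) A))) (reduced-top r 0 h))
  block-upper (suc K) a n 1≤a h | r@(reduction A (suc m) d₁ d₂ _ d₂≤P _ _) = begin
    P * block a (suc n)          ≡⟨ cong (P *_) (block≡ r) ⟩
    P * (suc m + B)              ≡⟨ *-distribˡ-+ P (suc m) B ⟩
    P * suc m + P * B            ≤⟨ +-monoʳ-≤ (P * suc m) IH ⟩
    P * suc m + (m + P * K)      ≡⟨ solve 4 (λ X m P K → X :+ (m :+ P :* K) := (m :+ X) :+ P :* K) refl (P * suc m) m P K ⟩
    (m + P * suc m) + P * K      ≤⟨ +-monoˡ-≤ (P * K) covered ⟩
    (n + P) + P * K              ≡⟨ +-assoc n P (P * K) ⟩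
    n + (P + P * K)              ≡⟨ cong (n +_) (*-suc P K) ⟨
    n + P * suc K                ∎
    where
    open ≤-Reasoning
    B = block (suc A) (suc m)
    IH : P * B ≤ m + P * K
    IH = block-upper K (suc A) m (s≤s z≤n) (reduced-top r (suc K) h)
    covered : m + P * suc m ≤ n + P
    covered = ≤-pred (begin
      p * suc m      ≤⟨ m≤n+m (p * suc m) d₁ ⟩
      d₁ + p * suc m ≡⟨ length≡ r ⟩
      suc n + d₂     ≤⟨ +-monoʳ-≤ (suc n) d₂≤P ⟩
      suc n + P      ∎)

  n<p^n : ∀ n → n < p ^ n
  n<p^n zero    = s≤s z≤n
  n<p^n (suc n) = begin-strict
    suc n                ≤⟨ n<p^n n ⟩
    p ^ n                <⟨ m<m+n (p ^ n) (m^n>0 p n) ⟩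
    p ^ n + p ^ n        ≤⟨ +-monoʳ-≤ (p ^ n) (m≤m+n (p ^ n) (k * p ^ n)) ⟩
    p ^ n + P * p ^ n    ∎
    where open ≤-Reasoning

  leastFromTo-sound : ∀ (Q : ℕ → Bool) j r → T (Q (j + r)) → T (Q (leastFromTo Q j r))
  leastFromTo-sound Q j zero    q = subst (λ i → T (Q i)) (+-identityʳ j) q
  leastFromTo-sound Q j (suc r) q with Q j in eq
  ... | true  = subst T (sym eq) _
  ... | false = leastFromTo-sound Q (suc j) r (subst (λ i → T (Q i)) (+-suc j r) q)

  greatestUpTo-maximal : ∀ (Q : ℕ → Bool) b j → greatestUpTo Q b < j → j ≤ b → ¬ T (Q j)
  greatestUpTo-maximal Q zero j g<j j≤b _ = <⇒≱ g<j j≤b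
  greatestUpTo-maximal Q (suc b) j g<j j≤b q with Q (suc b) in eq
  ... | true  = <⇒≱ g<j j≤b
  ... | false with m≤n⇒m<n∨m≡n j≤b
  ...   | inj₁ j<1+b = greatestUpTo-maximal Q b j g<j (≤-pred j<1+b) q
  ...   | inj₂ refl  = subst T eq q

  ceilLog-spec : ∀ l → l ≤ p ^ ceilLog p l
  ceilLog-spec l = toWitness (leastFromTo-sound (λ j → ⌊ l ≤? p ^ j ⌋) 0 l (fromWitness (<⇒≤ (n<p^n l))))

  floorLog-spec : ∀ n → n < p ^ suc (floorLog p n)
  floorLog-spec n with suc (floorLog p n) ≤? n
  ... | yes F<n = ≰⇒> (λ p^F≤n →
          greatestUpTo-maximal _ n (suc (floorLog p n)) ≤-refl F<n (fromWitness p^F≤n))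
  ... | no  F≮n = <-trans (≰⇒> F≮n) (n<p^n (suc (floorLog p n)))

  -- The sum of the theorem, a list sum over i < l, is a block sum read forwards (y > 0)
  -- or backwards (y ≤ -l).
  sum-ascending : ∀ l a (G : ℕ → ℕ) → (∀ i → G i ≡ v (a + i)) → sum (applyUpTo G l) ≡ block a l
  sum-ascending zero    a G G≡ = refl
  sum-ascending (suc l) a G G≡ =
    cong₂ _+_ (trans (G≡ 0) (cong v (+-identityʳ a)))
              (sum-ascending l (suc a) (λ i → G (suc i)) (λ i → trans (G≡ (suc i)) (cong v (+-suc a i))))

  sum-descending : ∀ l c (G : ℕ → ℕ) → (∀ i → i < l → G i ≡ v (c + (l ∸ i))) →
                   sum (applyUpTo G l) ≡ block (suc c) l
  sum-descending zero    c G G≡ = refl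
  sum-descending (suc m) c G G≡ = begin
    G 0 + sum (applyUpTo (λ i → G (suc i)) m)  ≡⟨ cong₂ _+_ (G≡ 0 (s≤s z≤n))
                                                     (sum-descending m c (λ i → G (suc i)) (λ i i<m → G≡ (suc i) (s≤s i<m))) ⟩
    v (c + suc m) + block (suc c) m            ≡⟨ +-comm (v (c + suc m)) (block (suc c) m) ⟩
    block (suc c) m + v (c + suc m)            ≡⟨ cong (λ b → block (suc c) m + v b) (+-suc c m) ⟩
    block (suc c) m + v (suc c + m)            ≡⟨ block-snoc (suc c) m ⟨
    block (suc c) (suc m)                      ∎
    where open ≡-Reasoning

  -- The values |y|, …, |y+l-1| form the block [s+1, s+l], in some order, and the top
  -- s + l of the block is one of the endpoints |y|, |y+l-1|.
  record Window (y : ℤ) (l : ℕ) : Set where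
    constructor window
    field
      s    : ℕ
      sum≡ : sum (map (λ i → vp p (y ℤ.+ ℤ.+ i)) (upTo l)) ≡ block (suc s) l
      top  : s + l ≡ ∣ y ∣ ⊎ s + l ≡ ∣ y ℤ.+ ℤ.+ (l ∸ 1) ∣

  positive-window : ∀ c l₀ → Window (ℤ.+ suc c) (suc l₀)
  positive-window c l₀ = window c sum≡ (inj₂ (+-suc c l₀))
    where
    G : ℕ → ℕ
    G i = vp p (ℤ.+ suc c ℤ.+ ℤ.+ i)
    sum≡ : sum (map G (upTo (suc l₀))) ≡ block (suc c) (suc l₀)
    sum≡ = trans (cong sum (map-applyUpTo (λ i → i) G (suc l₀))) (sum-ascending (suc l₀) (suc c) G (λ _ → refl))

  negative-length : ∀ N l → ℤ.-[1+ N ] ℤ.< ℤ.+ 1 ℤ.- ℤ.+ l → l ≤ suc N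
  negative-length N l y<1-l with l ≤? suc N
  ... | yes l≤1+N = l≤1+N
  ... | no  l≰1+N with m≤n⇒∃[o]m+o≡n (≰⇒> l≰1+N)
  ...   | t , refl with y<1-l
  ...     | ℤ.-<- N>N+t = ⊥-elim (<⇒≱ N>N+t (m≤m+n N t))

  -- For y = -(N+1) ≤ -l the values |y+i| = N+1-i are c+l, …, c+1 with c = N+1-l.
  negative-window : ∀ N l → ℤ.-[1+ N ] ℤ.< ℤ.+ 1 ℤ.- ℤ.+ l → Window ℤ.-[1+ N ] l
  negative-window N l y<1-l with m≤n⇒∃[o]m+o≡n (negative-length N l y<1-l)
  ... | c , l+c≡1+N = window c sum≡ (inj₁ c+l≡1+N)
    where
    c+l≡1+N : c + l ≡ suc N
    c+l≡1+N = trans (+-comm c l) l+c≡1+N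
    G : ℕ → ℕ
    G i = vp p (ℤ.-[1+ N ] ℤ.+ ℤ.+ i)
    G≡ : ∀ i → i < l → G i ≡ v (c + (l ∸ i))
    G≡ i i<l = cong v (begin
      ∣ i ℤ.⊖ suc N ∣            ≡⟨ cong ∣_∣ (ℤP.⊖-≤ i≤1+N) ⟩
      ∣ ℤ.- ℤ.+ (suc N ∸ i) ∣    ≡⟨ ℤP.∣-i∣≡∣i∣ (ℤ.+ (suc N ∸ i)) ⟩
      suc N ∸ i                  ≡⟨ cong (_∸ i) c+l≡1+N ⟨
      c + l ∸ i                  ≡⟨ +-∸-assoc c (<⇒≤ i<l) ⟩
      c + (l ∸ i)                ∎)
      where
      open ≡-Reasoning
      i≤1+N : i ≤ suc N
      i≤1+N = ≤-trans (<⇒≤ i<l) (≤-trans (m≤n+m l c) (≤-reflexive c+l≡1+N))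
    sum≡ : sum (map G (upTo l)) ≡ block (suc c) l
    sum≡ = trans (cong sum (map-applyUpTo (λ i → i) G l)) (sum-descending l c G G≡)

  window-of : ∀ y l₀ → ℤ.+ 0 ℤ.< y ⊎ y ℤ.< ℤ.+ 1 ℤ.- ℤ.+ suc l₀ → Window y (suc l₀)
  window-of (ℤ.+ suc c) l₀ _            = positive-window c l₀
  window-of (ℤ.+ zero)  l₀ (inj₁ (ℤ.+<+ ()))
  window-of ℤ.-[1+ N ]  l₀ (inj₁ ())
  window-of ℤ.-[1+ N ]  l₀ (inj₂ y<1-l) = negative-window N (suc l₀) y<1-l
  window-of (ℤ.+ n)     l₀ (inj₂ y<1-l) =
    ⊥-elim (ℤP.<⇒≱ (ℤP.<-≤-trans y<1-l 1-l≤0) (ℤ.+≤+ z≤n))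
    where
    1-l≤0 : ℤ.+ 1 ℤ.- ℤ.+ suc l₀ ℤ.≤ ℤ.+ 0
    1-l≤0 = subst (ℤ._≤ ℤ.+ 0) (sym (ℤP.[1+m]⊖[1+n]≡m⊖n 0 l₀)) (ℤP.m⊖n≤m 0 l₀)

  window-top : ∀ {y l} (w : Window y l) →
               suc (Window.s w) + l ≤ p ^ suc (floorLog p ∣ y ∣ ⊔ floorLog p ∣ y ℤ.+ ℤ.+ (l ∸ 1) ∣)
  window-top {y} {l} (window s _ top) = top-bound top
    where
    first last : ℕ
    first = ∣ y ∣
    last  = ∣ y ℤ.+ ℤ.+ (l ∸ 1) ∣
    F = floorLog p first ⊔ floorLog p last
    top-bound : s + l ≡ first ⊎ s + l ≡ last → s + l < p ^ suc F
    top-bound (inj₁ e) = subst (_< p ^ suc F) (sym e)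
      (<-≤-trans (floorLog-spec first) (^-monoʳ-≤ p (s≤s (m≤m⊔n (floorLog p first) (floorLog p last)))))
    top-bound (inj₂ e) = subst (_< p ^ suc F) (sym e)
      (<-≤-trans (floorLog-spec last) (^-monoʳ-≤ p (s≤s (m≤n⊔m (floorLog p first) (floorLog p last)))))

open import Data.Nat using (_⊔_; _∸_)
open import Data.Nat.Primality using (Prime)
open import Data.Integer using (ℤ; +_; ∣_∣)
open import Data.List using (map; upTo)
open import Data.Nat.ListAction using (sum)
open import Data.Rational using (_≤_; _+_; _-_)
open import Data.Product using (_×_; _,_)
open import Data.Sum using (_⊎_)
open import Data.Nat using (zero; suc)
open import Data.Nat.Primality using (¬prime[0]; ¬prime[1])
open import Data.Empty using (⊥-elim)

module RationalBounds where
  import Data.Nat as ℕ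
  import Data.Integer as ℤ
  import Data.Integer.Properties as ℤP
  open import Data.Integer.Solver using (module +-*-Solver)
  open +-*-Solver using (solve; _:+_; _:-_; :-_; _:*_; _:=_; con)
  open import Data.Rational using (_/_; -_; toℚᵘ)
  open import Data.Rational.Properties using (toℚᵘ-fromℚᵘ; toℚᵘ-homo-+; toℚᵘ-homo‿-; toℚᵘ-cancel-≤)
  open import Data.Rational.Unnormalised as U using (mkℚᵘ; *≤*)
  import Data.Rational.Unnormalised.Properties as UP
  open import Relation.Binary.PropositionalEquality

  toℚᵘ-/ : ∀ n d → toℚᵘ (+ n / suc d) U.≃ mkℚᵘ (+ n) d
  toℚᵘ-/ n d = toℚᵘ-fromℚᵘ (mkℚᵘ (+ n) d)

  toℚᵘ-homo-- : ∀ a b → toℚᵘ (a - b) U.≃ toℚᵘ a U.- toℚᵘ b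
  toℚᵘ-homo-- a b = UP.≃-trans (toℚᵘ-homo-+ a (- b)) (UP.+-congʳ (toℚᵘ a) (toℚᵘ-homo‿- b))

  lower-ℚ : ∀ k x c s → x ℕ.≤ suc k ℕ.* (s ℕ.+ c ℕ.+ 1) → (+ x / suc k - toℚ c) - toℚ 1 ≤ toℚ s
  lower-ℚ k x c s x≤ = toℚᵘ-cancel-≤ (UP.≤-respˡ-≃ (UP.≃-sym lhs≃) (UP.≤-respʳ-≃ (UP.≃-sym (toℚᵘ-/ s 0)) cross))
    where
    D = + suc k
    lhs≃ : toℚᵘ ((+ x / suc k - toℚ c) - toℚ 1) U.≃ (mkℚᵘ (+ x) k U.- mkℚᵘ (+ c) 0) U.- mkℚᵘ (+ 1) 0
    lhs≃ = UP.≃-trans (toℚᵘ-homo-- (+ x / suc k - toℚ c) (toℚ 1))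
             (UP.+-cong (UP.≃-trans (toℚᵘ-homo-- (+ x / suc k) (toℚ c)) (UP.+-cong (toℚᵘ-/ x k) (UP.-‿cong (toℚᵘ-/ c 0))))
                        (UP.-‿cong (toℚᵘ-/ 1 0)))
    x≤ℤ : + x ℤ.≤ D ℤ.* (+ s ℤ.+ + c ℤ.+ + 1)
    x≤ℤ = subst (+ x ℤ.≤_) (ℤP.pos-* (suc k) (s ℕ.+ c ℕ.+ 1)) (ℤ.+≤+ x≤)
    cross : (mkℚᵘ (+ x) k U.- mkℚᵘ (+ c) 0) U.- mkℚᵘ (+ 1) 0 U.≤ mkℚᵘ (+ s) 0
    cross = *≤* (subst₂ ℤ._≤_ (sym lhs-num) (sym rhs-num) (ℤP.+-monoˡ-≤ (ℤ.- (D ℤ.* (+ c ℤ.+ + 1))) x≤ℤ))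
      where
      lhs-num : ((+ x ℤ.* + 1 ℤ.+ ℤ.- + c ℤ.* D) ℤ.* + 1 ℤ.+ ℤ.- + 1 ℤ.* + (suc k ℕ.* 1)) ℤ.* + 1
                ≡ + x ℤ.- D ℤ.* (+ c ℤ.+ + 1)
      lhs-num = trans (cong (λ z → ((+ x ℤ.* + 1 ℤ.+ ℤ.- + c ℤ.* D) ℤ.* + 1 ℤ.+ ℤ.- + 1 ℤ.* z) ℤ.* + 1) (ℤP.pos-* (suc k) 1))
        (solve 3 (λ X C D → ((X :* con (+ 1) :+ (:- C) :* D) :* con (+ 1) :+ (:- con (+ 1)) :* (D :* con (+ 1))) :* con (+ 1)
                            := X :- D :* (C :+ con (+ 1))) refl (+ x) (+ c) D)
      rhs-num : + s ℤ.* + (suc k ℕ.* 1 ℕ.* 1) ≡ D ℤ.* (+ s ℤ.+ + c ℤ.+ + 1) ℤ.- D ℤ.* (+ c ℤ.+ + 1)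
      rhs-num = trans (cong (+ s ℤ.*_) (trans (ℤP.pos-* (suc k ℕ.* 1) 1) (cong (ℤ._* + 1) (ℤP.pos-* (suc k) 1))))
        (solve 3 (λ S C D → S :* (D :* con (+ 1) :* con (+ 1)) := D :* (S :+ C :+ con (+ 1)) :- D :* (C :+ con (+ 1)))
                 refl (+ s) (+ c) D)

  upper-ℚ : ∀ k x K s → suc k ℕ.* s ℕ.≤ x ℕ.+ suc k ℕ.* K → toℚ s ≤ + x / suc k + toℚ K
  upper-ℚ k x K s s≤ = toℚᵘ-cancel-≤ (UP.≤-respˡ-≃ (UP.≃-sym (toℚᵘ-/ s 0)) (UP.≤-respʳ-≃ (UP.≃-sym rhs≃) cross))
    where
    D = + suc k
    rhs≃ : toℚᵘ (+ x / suc k + toℚ K) U.≃ mkℚᵘ (+ x) k U.+ mkℚᵘ (+ K) 0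
    rhs≃ = UP.≃-trans (toℚᵘ-homo-+ (+ x / suc k) (toℚ K)) (UP.+-cong (toℚᵘ-/ x k) (toℚᵘ-/ K 0))
    s≤ℤ : D ℤ.* + s ℤ.≤ + x ℤ.+ D ℤ.* + K
    s≤ℤ = subst₂ ℤ._≤_ (ℤP.pos-* (suc k) s)
            (trans (ℤP.pos-+ x (suc k ℕ.* K)) (cong (λ z → + x ℤ.+ z) (ℤP.pos-* (suc k) K))) (ℤ.+≤+ s≤)
    cross : mkℚᵘ (+ s) 0 U.≤ mkℚᵘ (+ x) k U.+ mkℚᵘ (+ K) 0
    cross = *≤* (subst₂ ℤ._≤_ (sym lhs-num) (sym rhs-num) s≤ℤ)
      where
      lhs-num : + s ℤ.* + (suc k ℕ.* 1) ≡ D ℤ.* + s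
      lhs-num = trans (cong (+ s ℤ.*_) (ℤP.pos-* (suc k) 1))
                  (solve 2 (λ S D → S :* (D :* con (+ 1)) := D :* S) refl (+ s) D)
      rhs-num : (+ x ℤ.* + 1 ℤ.+ + K ℤ.* D) ℤ.* + 1 ≡ + x ℤ.+ D ℤ.* + K
      rhs-num = solve 3 (λ X K D → (X :* con (+ 1) :+ K :* D) :* con (+ 1) := X :+ D :* K) refl (+ x) (+ K) D

module WindowBounds (k : ℕ) where
  open BlockSums k
  open RationalBounds
  import Data.Integer as ℤ
  open import Data.Nat using (s≤s; z≤n)

  window-bounds : ∀ l₀ y → Window y (suc l₀) →
    let S = sum (map (λ i → vp p (y ℤ.+ + i)) (upTo (suc l₀))) in
    ((divPm1 (+ suc l₀) p - toℚ (ceilLog p (suc l₀))) - toℚ 1 ≤ toℚ S)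
    × (toℚ S ≤ divPm1 (+ l₀) p + toℚ (floorLog p ∣ y ∣ ⊔ floorLog p ∣ y ℤ.+ + l₀ ∣))
  window-bounds l₀ y w@(window c sum≡ _) rewrite sum≡ =
      lower-ℚ k (suc l₀) (ceilLog p (suc l₀)) B
        (block-lower (ceilLog p (suc l₀)) (suc c) (suc l₀) (s≤s z≤n) (ceilLog-spec (suc l₀)))
    , upper-ℚ k l₀ F B (block-upper F (suc c) l₀ (s≤s z≤n) (window-top w))
    where
    B = block (suc c) (suc l₀)
    F = floorLog p ∣ y ∣ ⊔ floorLog p ∣ y ℤ.+ + l₀ ∣

lemma3p5 : (p : ℕ) → Prime p → (l : ℕ) → 0 Data.Nat.< l → (y : ℤ) →
    (Data.Integer._<_ (+ 0) y ⊎ Data.Integer._<_ y (Data.Integer._-_ (+ 1) (+ l))) →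
    let S = sum (map (λ i → vp p (Data.Integer._+_ y (+ i))) (upTo l)) in
    ((divPm1 (+ l) p - toℚ (ceilLog p l)) - toℚ 1 ≤ toℚ S)
    × (toℚ S ≤ divPm1 (+ (l ∸ 1)) p
    + toℚ (floorLog p ∣ y ∣ ⊔ floorLog p ∣ Data.Integer._+_ y (+ (l ∸ 1)) ∣))
lemma3p5 zero          0-prime = ⊥-elim (¬prime[0] 0-prime)
lemma3p5 (suc zero)    1-prime = ⊥-elim (¬prime[1] 1-prime)
lemma3p5 (suc (suc k)) _ (suc l₀) _ y hyp = WindowBounds.window-bounds k l₀ y (BlockSums.window-of k y l₀ hyp)
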